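{- Let $h_1\ge h_2\ge\dots\ge h_n>0$ be integers. If a $\mathrm{LS}(h_1\dots h_n)$ exists, then a $\mathrm{LC}(h_1\dots h_n)$ exists.
   Context: Let $N=h_1+\dots+h_n$. A latin square of order $N$ is an $N\times N$ array on $N$ symbols in which each symbol occurs exactly once in each row and column; a subsquare is an $m\times m$ subarray (rows and columns from chosen $m$-sets) that is itself a latin square of order $m$; subsquares are disjoint if they share no row, column or symbol. A $\mathrm{LS}(h_1\dots h_n)$ (2-realization) is a latin square of order $N$ with pairwise disjoint subsquares of orders $h_1,\dots,h_n$. A latin cube of order $N$ is an $N\times N\times N$ array on $N$ symbols such that any two cells whose coordinates differ in exactly one position contain different symbols; a subcube is an $m\times m\times m$ subarray (indices in each coordinate from chosen $m$-sets) that is itself a latin cube of order $m$; subcubes are disjoint if they share no row, column, file (i.e. no index in any coordinate) or symbol. A $\mathrm{LC}(h_1\dots h_n)$ (3-realization) is a latin cube of order $N$ with pairwise disjoint subcubes of orders $h_1,\dots,h_n$. -}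

module Defs where

open import Data.Nat using (ℕ; _+_; _≥_; _>_)
open import Data.Fin using (Fin; _≤_)
open import Data.Product using (Σ; _×_)
open import Data.Vec.Functional using (foldr)
open import Relation.Binary.PropositionalEquality using (_≡_; _≢_)
open import Function.Definitions using (Injective; Bijective)

total : ∀ {n} → (Fin n → ℕ) → ℕ
total h = foldr _+_ 0 h

NonIncreasingPositive : ∀ {n} → (Fin n → ℕ) → Set
NonIncreasingPositive {n} h = (∀ (i j : Fin n) → i ≤ j → h i ≥ h j) × (∀ i → h i > 0)

Square : ℕ → Set
Square N = Fin N → Fin N → Fin N

IsLatinSquare : ∀ {N} → Square N → Set
IsLatinSquare {N} L =
  (∀ r → Bijective _≡_ _≡_ (λ c → L r c)) × (∀ c → Bijective _≡_ _≡_ (λ r → L r c))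

Cube : ℕ → Set
Cube N = Fin N → Fin N → Fin N → Fin N

IsLatinCube : ∀ {N} → Cube N → Set
IsLatinCube {N} C =
  (∀ y z → Injective _≡_ _≡_ (λ x → C x y z)) ×
  (∀ x z → Injective _≡_ _≡_ (λ y → C x y z)) ×
  (∀ x y → Injective _≡_ _≡_ (λ z → C x y z))

record Subsquare {N : ℕ} (L : Square N) (m : ℕ) : Set where
  field
    rows cols syms : Fin m → Fin N
    rows-inj : Injective _≡_ _≡_ rows
    cols-inj : Injective _≡_ _≡_ cols
    syms-inj : Injective _≡_ _≡_ syms
    sub      : Square m
    sub-latin : IsLatinSquare sub
    agree    : ∀ i j → L (rows i) (cols j) ≡ syms (sub i j)

record Subcube {N : ℕ} (C : Cube N) (m : ℕ) : Set where
  field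
    rows cols files syms : Fin m → Fin N
    rows-inj  : Injective _≡_ _≡_ rows
    cols-inj  : Injective _≡_ _≡_ cols
    files-inj : Injective _≡_ _≡_ files
    syms-inj  : Injective _≡_ _≡_ syms
    sub       : Cube m
    sub-latin : IsLatinCube sub
    agree     : ∀ i j k → C (rows i) (cols j) (files k) ≡ syms (sub i j k)

Disj : ∀ {a b N} → (Fin a → Fin N) → (Fin b → Fin N) → Set
Disj f g = ∀ i j → f i ≢ g j

LS : ∀ {n} → (Fin n → ℕ) → Set
LS {n} h =
  Σ (Square (total h)) λ L → IsLatinSquare L ×
  Σ ((k : Fin n) → Subsquare L (h k)) λ S →
    ∀ k l → k ≢ l →
      Disj (Subsquare.rows (S k)) (Subsquare.rows (S l)) ×
      Disj (Subsquare.cols (S k)) (Subsquare.cols (S l)) ×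
      Disj (Subsquare.syms (S k)) (Subsquare.syms (S l))

LC : ∀ {n} → (Fin n → ℕ) → Set
LC {n} h =
  Σ (Cube (total h)) λ C → IsLatinCube C ×
  Σ ((k : Fin n) → Subcube C (h k)) λ S →
    ∀ k l → k ≢ l →
      Disj (Subcube.rows (S k)) (Subcube.rows (S l)) ×
      Disj (Subcube.cols (S k)) (Subcube.cols (S l)) ×
      Disj (Subcube.files (S k)) (Subcube.files (S l)) ×
      Disj (Subcube.syms (S k)) (Subcube.syms (S l))

-- Given a latin square L, set C(x, y, z) = L(x, c) where c is the column in which row y
-- of L carries the symbol z. Each line of C through a cell is injective because L is latin,
-- and a subsquare of L on rows R, columns K and symbols S becomes a subcube of C on
-- rows R, columns R, files S and symbols S: inside the subsquare, the column carrying a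
-- symbol of S in a row of R lies in K. Disjointness of the subcubes is thus inherited
-- from the disjointness of rows and of symbols of the subsquares.
module Submission where

open import Data.Nat using (ℕ)
open import Data.Fin using (Fin)
open import Data.Product using (_,_; proj₁; proj₂)
open import Function.Definitions using (Injective)
open import Relation.Binary.PropositionalEquality
open ≡-Reasoning
open import Defs

module _ {N : ℕ} {L : Square N} (latin : IsLatinSquare L) where

  rowInjective : ∀ r → Injective _≡_ _≡_ (L r)
  rowInjective r = proj₁ (proj₁ latin r)

  columnInjective : ∀ c → Injective _≡_ _≡_ (λ r → L r c)
  columnInjective c = proj₁ (proj₂ latin c)

  columnOf : Fin N → Fin N → Fin N
  columnOf r s = proj₁ (proj₂ (proj₁ latin r) s)

  L-columnOf : ∀ r s → L r (columnOf r s) ≡ s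
  L-columnOf r s = proj₂ (proj₂ (proj₁ latin r) s) refl

  columnOf-unique : ∀ {r s c} → L r c ≡ s → c ≡ columnOf r s
  columnOf-unique {r} {s} {c} eq = rowInjective r (trans eq (sym (L-columnOf r s)))

  toCube : Cube N
  toCube x y z = L x (columnOf y z)

  toCube-injectiveˣ : ∀ y z → Injective _≡_ _≡_ (λ x → toCube x y z)
  toCube-injectiveˣ y z = columnInjective (columnOf y z)

  toCube-injectiveʸ : ∀ x z → Injective _≡_ _≡_ (λ y → toCube x y z)
  toCube-injectiveʸ x z {y} {y′} eq = columnInjective (columnOf y z) (begin
    L y  (columnOf y z)   ≡⟨ L-columnOf y z ⟩
    z                     ≡⟨ L-columnOf y′ z ⟨
    L y′ (columnOf y′ z)  ≡⟨ cong (L y′) (rowInjective x eq) ⟨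
    L y′ (columnOf y z)   ∎)

  toCube-injectiveᶻ : ∀ x y → Injective _≡_ _≡_ (λ z → toCube x y z)
  toCube-injectiveᶻ x y {z} {z′} eq = begin
    z                    ≡⟨ L-columnOf y z ⟨
    L y (columnOf y z)   ≡⟨ cong (L y) (rowInjective x eq) ⟩
    L y (columnOf y z′)  ≡⟨ L-columnOf y z′ ⟩
    z′                   ∎

  toCube-latin : IsLatinCube toCube
  toCube-latin = toCube-injectiveˣ , toCube-injectiveʸ , toCube-injectiveᶻ

module _ {N : ℕ} {L : Square N} (latin : IsLatinSquare L) {m : ℕ} (S : Subsquare L m) where
  open Subsquare S

  cols-columnOf : ∀ i s → cols (columnOf sub-latin i s) ≡ columnOf latin (rows i) (syms s)
  cols-columnOf i s = columnOf-unique latin (begin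
    L (rows i) (cols (columnOf sub-latin i s))  ≡⟨ agree i (columnOf sub-latin i s) ⟩
    syms (sub i (columnOf sub-latin i s))       ≡⟨ cong syms (L-columnOf sub-latin i s) ⟩
    syms s                                      ∎)

  toSubcube : Subcube (toCube latin) m
  toSubcube = record
    { rows = rows ; cols = rows ; files = syms ; syms = syms
    ; rows-inj = rows-inj ; cols-inj = rows-inj ; files-inj = syms-inj ; syms-inj = syms-inj
    ; sub = toCube sub-latin
    ; sub-latin = toCube-latin sub-latin
    ; agree = λ i j k → begin
        L (rows i) (columnOf latin (rows j) (syms k))  ≡⟨ cong (L (rows i)) (cols-columnOf j k) ⟨
        L (rows i) (cols (columnOf sub-latin j k))      ≡⟨ agree i (columnOf sub-latin j k) ⟩
        syms (sub i (columnOf sub-latin j k))           ∎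
    }

theorem8 : (n : ℕ) (h : Fin n → ℕ) → NonIncreasingPositive h → LS h → LC h
theorem8 n h _ (L , latin , S , disjoint) =
  toCube latin , toCube-latin latin , (λ k → toSubcube latin (S k)) , λ k l k≢l →
    let rowsDisjoint = proj₁ (disjoint k l k≢l)
        symsDisjoint = proj₂ (proj₂ (disjoint k l k≢l))
    in rowsDisjoint , rowsDisjoint , symsDisjoint , symsDisjoint
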